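{- Suppose that $n$ is a positive integer which is not a power of two. Then there are $x,y,z\in\mathbb{Z}$ with $|x|<n$ and $|y|<n$ such that $x^2+y^2+5z^2=n^2$.
   Context: Powers of two include $2^0=1$. -}

module Defs where

open import Data.Nat using (ℕ; _^_)
open import Data.Product using (∃)
open import Relation.Binary.PropositionalEquality using (_≡_)

IsPowerOfTwo : ℕ → Set
IsPowerOfTwo n = ∃ λ k → n ≡ 2 ^ k

module Submission where

-- Since solutions scale, it suffices to treat an odd prime p, and 5² = 3² + 4². Otherwise write
-- p = |q|² for an integer quaternion q (Lagrange's four-square theorem, by Euler's descent). The
-- rotation v ↦ q v q̄ of ℤ³ multiplies squared lengths by p², so it sends a vector u with |u|² = 5 to
-- a vector w with |w|² = 5p². If u is orthogonal modulo 5 to the first row of the rotation matrix,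
-- then 5 ∣ w₁, hence w = (5X, Y + 2Z, ±(2Y − Z)) and Y² + Z² + 5X² = p², a proper solution unless
-- p divides w. Modulo 5 every such row is orthogonal to both vectors u, v of one of five orthogonal
-- pairs of norm 5, and p cannot divide both rotated vectors: the frame u, v, u × v spans 25ℤ³, so p
-- would divide the whole rotation matrix, hence q, contradicting |q|² = p.

open import Defs
open import Algebra.Bundles.Raw using (RawRing)
open import Data.Empty using (⊥; ⊥-elim)
open import Data.Fin using (Fin; toℕ; fromℕ<)
open import Data.Fin.Properties using (pigeonhole; toℕ<n; toℕ-fromℕ<)
open import Data.Integer using (ℤ; +_; -[1+_]; ∣_∣)
import Data.Integer as ℤ
import Data.Integer.Properties as ℤ
open import Data.Integer.DivMod using (_%ℕ_; _/ℕ_; n%ℕd<d; a≡a%ℕn+[a/ℕn]*n)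
open import Data.Integer.Divisibility.Signed
  using (_∣_; divides; _∣?_; ∣-refl; ∣-trans; ∣ᵤ⇒∣; ∣⇒∣ᵤ; ∣m∣n⇒∣m+n; ∣m∣n⇒∣m-n; ∣m+n∣n⇒∣m; ∣m+n∣m⇒∣n
        ; ∣m⇒∣-m; ∣n⇒∣m*n; ∣m⇒∣m*n; *-monoʳ-∣; *-monoˡ-∣; *-cancelˡ-∣)
open import Data.Integer.Tactic.RingSolver using (solve-∀; ring)
open import Data.List using (List; []; _∷_; map; upTo; length)
open import Data.List.Membership.Propositional using (_∈_; find)
open import Data.List.Membership.Propositional.Properties using (∈-map⁺; ∈-upTo⁺)
open import Data.List.Relation.Unary.All as All using (All; all?; []; _∷_)
open import Data.List.Relation.Unary.All.Properties using (¬All⇒Any¬)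
open import Data.List.Relation.Unary.Any as Any using (Any; any?)
open import Data.Nat as ℕ using (ℕ; suc; _>_; _<_; _≤_; _^_)
import Data.Nat.DivMod as ℕ
import Data.Nat.Divisibility as ℕ
open import Data.Nat.Induction using (<-rec)
open import Data.Nat.ListAction using (product)
open import Data.Nat.ListAction.Properties using (∈⇒∣product)
open import Data.Nat.Primality
  using (Prime; euclidsLemma; prime⇒irreducible; prime⇒nonZero; prime⇒nonTrivial; prime[2]; prime?)
open import Data.Nat.Primality.Factorisation using (factorise; module PrimeFactorisation)
import Data.Nat.Properties as ℕ
import Data.Nat.Tactic.RingSolver as ℕ-Ring
open import Data.Product using (∃; ∃-syntax; _×_; _,_; proj₁; proj₂)
open import Data.Sum using (_⊎_; inj₁; inj₂)
import Data.Sum as Sum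
open import Data.Unit using (tt)
open import Function using (id; case_of_)
open import Function.Bundles using (_⇔_; mk⇔; Equivalence)
open import Level using (0ℓ)
open import Relation.Binary.PropositionalEquality
  using (_≡_; _≢_; refl; sym; trans; cong; cong₂; subst; subst₂; module ≡-Reasoning)
open import Relation.Nullary using (¬_; yes; no)
open import Relation.Nullary.Decidable using (Dec; toWitness; _⊎-dec_; _×-dec_; _→-dec_)
open import Tactic.RingSolver.Core.Expression using (Expr; Κ)
import Tactic.RingSolver.Core.Expression as Expr
open import Tactic.RingSolver.NonReflective ring using (solve; _⊜_)

-- Quaternions and rotations

record Quaternion (A : Set) : Set where
  constructor quaternion
  field re i j k : A

record Vector (A : Set) : Set where
  constructor ⟨_,_,_⟩
  field x₁ x₂ x₃ : A

-- The operations are defined over any raw ring so that, instantiated with the ring solver's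
-- expressions (module E below), they evaluate definitionally to the integer operations.
module Operations (R : RawRing 0ℓ 0ℓ) where
  open RawRing R renaming (Carrier to A)

  private
    infixl 6 _-_
    _-_ : A → A → A
    x - y = x + - y

  infixl 6 _⊕_ _⊕ᵥ_
  infixr 7 _⊛_ _⊛ᵥ_
  infixl 7 _∙_
  infix 8 _·_
  infixl 9 _⨯_

  real : A → Quaternion A
  real a = quaternion a 0# 0# 0#

  conj : Quaternion A → Quaternion A
  conj (quaternion a b c d) = quaternion a (- b) (- c) (- d)

  norm : Quaternion A → A
  norm (quaternion a b c d) = a * a + b * b + c * c + d * d

  _⊕_ : Quaternion A → Quaternion A → Quaternion A
  quaternion a b c d ⊕ quaternion a′ b′ c′ d′ = quaternion (a + a′) (b + b′) (c + c′) (d + d′)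

  _⊛_ : A → Quaternion A → Quaternion A
  m ⊛ quaternion a b c d = quaternion (m * a) (m * b) (m * c) (m * d)

  _∙_ : Quaternion A → Quaternion A → Quaternion A
  quaternion a b c d ∙ quaternion a′ b′ c′ d′ = quaternion
    (a * a′ - b * b′ - c * c′ - d * d′)
    (a * b′ + b * a′ + c * d′ - d * c′)
    (a * c′ - b * d′ + c * a′ + d * b′)
    (a * d′ + b * c′ - c * b′ + d * a′)

  _⊕ᵥ_ : Vector A → Vector A → Vector A
  ⟨ a , b , c ⟩ ⊕ᵥ ⟨ a′ , b′ , c′ ⟩ = ⟨ a + a′ , b + b′ , c + c′ ⟩

  _⊛ᵥ_ : A → Vector A → Vector A
  m ⊛ᵥ ⟨ a , b , c ⟩ = ⟨ m * a , m * b , m * c ⟩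

  _·_ : Vector A → Vector A → A
  ⟨ a , b , c ⟩ · ⟨ a′ , b′ , c′ ⟩ = a * a′ + b * b′ + c * c′

  ∣_∣² : Vector A → A
  ∣ v ∣² = v · v

  _⨯_ : Vector A → Vector A → Vector A
  ⟨ a , b , c ⟩ ⨯ ⟨ a′ , b′ , c′ ⟩ = ⟨ b * c′ - c * b′ , c * a′ - a * c′ , a * b′ - b * a′ ⟩

  e₁ e₂ e₃ : Vector A
  e₁ = ⟨ 1# , 0# , 0# ⟩
  e₂ = ⟨ 0# , 1# , 0# ⟩
  e₃ = ⟨ 0# , 0# , 1# ⟩

  pure : Vector A → Quaternion A
  pure ⟨ a , b , c ⟩ = quaternion 0# a b c

  vector : Quaternion A → Vector A
  vector (quaternion _ b c d) = ⟨ b , c , d ⟩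

  rotate : Quaternion A → Vector A → Vector A
  rotate q v = vector (q ∙ pure v ∙ conj q)

ℍ : Set
ℍ = Quaternion ℤ

ℤ³ : Set
ℤ³ = Vector ℤ

expressions : ℕ → RawRing 0ℓ 0ℓ
expressions n = record
  { Carrier = Expr ℤ n
  ; _≈_     = _≡_
  ; _+_     = Expr._⊕_
  ; _*_     = Expr._⊗_
  ; -_      = Expr.⊝_
  ; 0#      = Κ (+ 0)
  ; 1#      = Κ (+ 1)
  }

module E {n : ℕ} where
  open RawRing (expressions n) public using (_+_; _*_; -_)
  open Operations (expressions n) public

  infixl 6 _-_
  _-_ : Expr ℤ n → Expr ℤ n → Expr ℤ n
  x - y = x + - y

open Operations ℤ.+-*-rawRing
open import Data.Integer using (-_; _+_; _-_; _*_)

ℍ-cong : ∀ {a b c d a′ b′ c′ d′ : ℤ} → a ≡ a′ → b ≡ b′ → c ≡ c′ → d ≡ d′ →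
         quaternion a b c d ≡ quaternion a′ b′ c′ d′
ℍ-cong refl refl refl refl = refl

ℤ³-cong : ∀ {a b c a′ b′ c′ : ℤ} → a ≡ a′ → b ≡ b′ → c ≡ c′ → ⟨ a , b , c ⟩ ≡ ⟨ a′ , b′ , c′ ⟩
ℤ³-cong refl refl refl = refl

⊕-identityˡ : ∀ q → real (+ 0) ⊕ q ≡ q
⊕-identityˡ (quaternion a b c d) =
  ℍ-cong (ℤ.+-identityˡ a) (ℤ.+-identityˡ b) (ℤ.+-identityˡ c) (ℤ.+-identityˡ d)

-- Polynomial identities

norm-conj : ∀ q → norm (conj q) ≡ norm q
norm-conj (quaternion a b c d) = solve 4
  (λ a b c d → let q = quaternion a b c d in E.norm (E.conj q) ⊜ E.norm q)
  refl a b c d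

norm-⊛ : ∀ k q → norm (k ⊛ q) ≡ k * k * norm q
norm-⊛ k (quaternion a b c d) = solve 5
  (λ k a b c d → let q = quaternion a b c d in E.norm (k E.⊛ q) ⊜ k E.* k E.* E.norm q)
  refl k a b c d

norm-⊕⊛ : ∀ y k t → norm (y ⊕ k ⊛ t) ≡ norm y + k * (+ 2 * Quaternion.re (t ∙ conj y) + k * norm t)
norm-⊕⊛ (quaternion a b c d) k (quaternion a′ b′ c′ d′) = solve 9
  (λ a b c d k a′ b′ c′ d′ → let y = quaternion a b c d; t = quaternion a′ b′ c′ d′ in
    E.norm (y E.⊕ k E.⊛ t)
      ⊜ (E.norm y E.+ k E.* (Κ (+ 2) E.* Quaternion.re (t E.∙ E.conj y) E.+ k E.* E.norm t)))
  refl a b c d k a′ b′ c′ d′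

norm-real⊕⊛ : ∀ k r s → norm (real (k * r) ⊕ k ⊛ s) ≡ k * k * norm (real r ⊕ s)
norm-real⊕⊛ k r (quaternion a b c d) = solve 6
  (λ k r a b c d → let s = quaternion a b c d in
    E.norm (E.real (k E.* r) E.⊕ k E.⊛ s) ⊜ k E.* k E.* E.norm (E.real r E.⊕ s))
  refl k r a b c d

-- Euler's four-square identity, applied to (y + k t) ȳ = |y|² + k t ȳ.
euler-identity : ∀ y k t → norm (y ⊕ k ⊛ t) * norm y ≡ norm (real (norm y) ⊕ k ⊛ (t ∙ conj y))
euler-identity (quaternion a b c d) k (quaternion a′ b′ c′ d′) = solve 9
  (λ a b c d k a′ b′ c′ d′ → let y = quaternion a b c d; t = quaternion a′ b′ c′ d′ in
    E.norm (y E.⊕ k E.⊛ t) E.* E.norm y ⊜ E.norm (E.real (E.norm y) E.⊕ k E.⊛ (t E.∙ E.conj y)))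
  refl a b c d k a′ b′ c′ d′

norm-odd : ∀ a b c d → norm (quaternion (+ 2 * a + + 1) (+ 2 * b + + 1) (+ 2 * c + + 1) (+ 2 * d + + 1))
                       ≡ + 4 * (a * a + a + b * b + b + c * c + c + d * d + d + + 1)
norm-odd = solve 4
  (λ a b c d → let odd = λ x → Κ (+ 2) E.* x E.+ Κ (+ 1) in
    E.norm (quaternion (odd a) (odd b) (odd c) (odd d))
      ⊜ Κ (+ 4) E.* (a E.* a E.+ a E.+ b E.* b E.+ b E.+ c E.* c E.+ c E.+ d E.* d E.+ d E.+ Κ (+ 1)))
  refl

norm-a+bi+j : ∀ a b → norm (quaternion a b (+ 1) (+ 0)) ≡ a * a + b * b + + 1
norm-a+bi+j = solve 2
  (λ a b → E.norm (quaternion a b (Κ (+ 1)) (Κ (+ 0))) ⊜ (a E.* a E.+ b E.* b E.+ Κ (+ 1)))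
  refl

∣rotate∣² : ∀ q v → ∣ rotate q v ∣² ≡ norm q * norm q * ∣ v ∣²
∣rotate∣² (quaternion a b c d) ⟨ x , y , z ⟩ = solve 7
  (λ a b c d x y z → let q = quaternion a b c d; v = ⟨ x , y , z ⟩ in
    E.∣ E.rotate q v ∣² ⊜ E.norm q E.* E.norm q E.* E.∣ v ∣²)
  refl a b c d x y z

rotate-⨯ : ∀ q u v s → rotate q u ⨯ rotate q v · s ≡ norm q * (rotate q (u ⨯ v) · s)
rotate-⨯ (quaternion a b c d) ⟨ x , y , z ⟩ ⟨ x′ , y′ , z′ ⟩ ⟨ s₁ , s₂ , s₃ ⟩ = solve 13
  (λ a b c d x y z x′ y′ z′ s₁ s₂ s₃ →
    let q = quaternion a b c d; u = ⟨ x , y , z ⟩; v = ⟨ x′ , y′ , z′ ⟩; s = ⟨ s₁ , s₂ , s₃ ⟩ in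
    E.rotate q u E.⨯ E.rotate q v E.· s ⊜ E.norm q E.* (E.rotate q (u E.⨯ v) E.· s))
  refl a b c d x y z x′ y′ z′ s₁ s₂ s₃

rotate-adjoint : ∀ q u v → rotate q u · v ≡ u · rotate (conj q) v
rotate-adjoint (quaternion a b c d) ⟨ x , y , z ⟩ ⟨ x′ , y′ , z′ ⟩ = solve 10
  (λ a b c d x y z x′ y′ z′ → let q = quaternion a b c d; u = ⟨ x , y , z ⟩; v = ⟨ x′ , y′ , z′ ⟩ in
    E.rotate q u E.· v ⊜ u E.· E.rotate (E.conj q) v)
  refl a b c d x y z x′ y′ z′

diagonal-identities : ∀ a b c d → let q = quaternion a b c d; δ = λ v → rotate q v · v in
  (+ 4 * (a * a) ≡ norm q + δ e₁ + δ e₂ + δ e₃) × (+ 4 * (b * b) ≡ norm q + δ e₁ - δ e₂ - δ e₃) ×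
  (+ 4 * (c * c) ≡ norm q - δ e₁ + δ e₂ - δ e₃) × (+ 4 * (d * d) ≡ norm q - δ e₁ - δ e₂ + δ e₃)
diagonal-identities a b c d =
  solve 4 (λ a b c d → let q = quaternion a b c d; δ = λ v → E.rotate q v E.· v in
    Κ (+ 4) E.* (a E.* a) ⊜ (E.norm q E.+ δ E.e₁ E.+ δ E.e₂ E.+ δ E.e₃)) refl a b c d ,
  solve 4 (λ a b c d → let q = quaternion a b c d; δ = λ v → E.rotate q v E.· v in
    Κ (+ 4) E.* (b E.* b) ⊜ (E.norm q E.+ δ E.e₁ E.- δ E.e₂ E.- δ E.e₃)) refl a b c d ,
  solve 4 (λ a b c d → let q = quaternion a b c d; δ = λ v → E.rotate q v E.· v in
    Κ (+ 4) E.* (c E.* c) ⊜ (E.norm q E.- δ E.e₁ E.+ δ E.e₂ E.- δ E.e₃)) refl a b c d ,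
  solve 4 (λ a b c d → let q = quaternion a b c d; δ = λ v → E.rotate q v E.· v in
    Κ (+ 4) E.* (d E.* d) ⊜ (E.norm q E.- δ E.e₁ E.- δ E.e₂ E.+ δ E.e₃)) refl a b c d

lagrange-identity : ∀ u v → ∣ u ⨯ v ∣² ≡ ∣ u ∣² * ∣ v ∣² - u · v * (u · v)
lagrange-identity ⟨ u₁ , u₂ , u₃ ⟩ ⟨ v₁ , v₂ , v₃ ⟩ = solve 6
  (λ u₁ u₂ u₃ v₁ v₂ v₃ → let u = ⟨ u₁ , u₂ , u₃ ⟩; v = ⟨ v₁ , v₂ , v₃ ⟩ in
    E.∣ u E.⨯ v ∣² ⊜ (E.∣ u ∣² E.* E.∣ v ∣² E.- u E.· v E.* (u E.· v)))
  refl u₁ u₂ u₃ v₁ v₂ v₃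

-- For u ⊥ v this expands a · b in the orthogonal basis u, v, u ⨯ v.
gram-identity : ∀ u v a b →
  ∣ u ⨯ v ∣² * (a · b) + u · v * ((u · a) * (v · b) + (v · a) * (u · b))
    ≡ ∣ v ∣² * ((u · a) * (u · b)) + ∣ u ∣² * ((v · a) * (v · b)) + (u ⨯ v · a) * (u ⨯ v · b)
gram-identity ⟨ u₁ , u₂ , u₃ ⟩ ⟨ v₁ , v₂ , v₃ ⟩ ⟨ a₁ , a₂ , a₃ ⟩ ⟨ b₁ , b₂ , b₃ ⟩ = solve 12
  (λ u₁ u₂ u₃ v₁ v₂ v₃ a₁ a₂ a₃ b₁ b₂ b₃ →
    let u = ⟨ u₁ , u₂ , u₃ ⟩; v = ⟨ v₁ , v₂ , v₃ ⟩; a = ⟨ a₁ , a₂ , a₃ ⟩; b = ⟨ b₁ , b₂ , b₃ ⟩ in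
    E.∣ u E.⨯ v ∣² E.* (a E.· b) E.+ u E.· v E.* ((u E.· a) E.* (v E.· b) E.+ (v E.· a) E.* (u E.· b))
      ⊜ (E.∣ v ∣² E.* ((u E.· a) E.* (u E.· b)) E.+ E.∣ u ∣² E.* ((v E.· a) E.* (v E.· b))
        E.+ (u E.⨯ v E.· a) E.* (u E.⨯ v E.· b)))
  refl u₁ u₂ u₃ v₁ v₂ v₃ a₁ a₂ a₃ b₁ b₂ b₃

∣⊕ᵥ⊛ᵥ∣² : ∀ r m k → ∣ r ⊕ᵥ m ⊛ᵥ k ∣² ≡ ∣ r ∣² + m * (+ 2 * (r · k) + m * ∣ k ∣²)
∣⊕ᵥ⊛ᵥ∣² ⟨ a , b , c ⟩ m ⟨ x , y , z ⟩ = solve 7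
  (λ a b c m x y z → let r = ⟨ a , b , c ⟩; k = ⟨ x , y , z ⟩ in
    E.∣ r E.⊕ᵥ m E.⊛ᵥ k ∣² ⊜ (E.∣ r ∣² E.+ m E.* (Κ (+ 2) E.* (r E.· k) E.+ m E.* E.∣ k ∣²)))
  refl a b c m x y z

·-⊕ᵥ⊛ᵥ : ∀ u r m k → u · (r ⊕ᵥ m ⊛ᵥ k) ≡ u · r + m * (u · k)
·-⊕ᵥ⊛ᵥ ⟨ a , b , c ⟩ ⟨ x , y , z ⟩ m ⟨ x′ , y′ , z′ ⟩ = solve 10
  (λ a b c x y z m x′ y′ z′ → let u = ⟨ a , b , c ⟩; r = ⟨ x , y , z ⟩; k = ⟨ x′ , y′ , z′ ⟩ in
    u E.· (r E.⊕ᵥ m E.⊛ᵥ k) ⊜ (u E.· r E.+ m E.* (u E.· k)))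
  refl a b c x y z m x′ y′ z′

·-e₁ : ∀ v → v · e₁ ≡ Vector.x₁ v
·-e₁ ⟨ a , b , c ⟩ = solve 3 (λ a b c → ⟨ a , b , c ⟩ E.· E.e₁ ⊜ a) refl a b c

∣lattice∣² : ∀ X Y Z →
  ∣ ⟨ + 5 * X , Y + + 2 * Z , + 2 * Y - Z ⟩ ∣² ≡ + 5 * (Y * Y + Z * Z + + 5 * (X * X))
∣lattice∣² = solve 3
  (λ X Y Z → E.∣ ⟨ Κ (+ 5) E.* X , Y E.+ Κ (+ 2) E.* Z , Κ (+ 2) E.* Y E.- Z ⟩ ∣²
               ⊜ Κ (+ 5) E.* (Y E.* Y E.+ Z E.* Z E.+ Κ (+ 5) E.* (X E.* X)))
  refl

∣⟨⟩∣²-factorisation : ∀ a b c →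
  ∣ ⟨ a , b , c ⟩ ∣² ≡ a * a + (b + + 2 * c) * (b + + 2 * (- c)) + + 5 * (c * c)
∣⟨⟩∣²-factorisation = solve 3
  (λ a b c → E.∣ ⟨ a , b , c ⟩ ∣²
    ⊜ (a E.* a E.+ (b E.+ Κ (+ 2) E.* c) E.* (b E.+ Κ (+ 2) E.* (E.- c)) E.+ Κ (+ 5) E.* (c E.* c)))
  refl

∣reflect∣² : ∀ a b c → ∣ ⟨ a , b , - c ⟩ ∣² ≡ ∣ ⟨ a , b , c ⟩ ∣²
∣reflect∣² = solve 3 (λ a b c → E.∣ ⟨ a , b , E.- c ⟩ ∣² ⊜ E.∣ ⟨ a , b , c ⟩ ∣²) refl

-- Divisibility by primes

∣prime⇒≡ : ∀ {p d} → Prime p → d ℕ.∣ p → 1 < d → d ≡ p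
∣prime⇒≡ pp d∣p 1<d with prime⇒irreducible pp d∣p
... | inj₁ refl = ⊥-elim (ℕ.<-irrefl refl 1<d)
... | inj₂ d≡p = d≡p

prime-∤-smaller : ∀ {p n} → Prime p → 0 < n → n < p → ¬ (+ p ∣ + n)
prime-∤-smaller {p} {suc n} pp _ n<p p∣n =
  ℕ.<⇒≱ n<p (ℕ.∣⇒≤ (∣⇒∣ᵤ p∣n))

euclidsLemmaℤ : ∀ {p} i j → Prime p → + p ∣ i * j → (+ p ∣ i) ⊎ (+ p ∣ j)
euclidsLemmaℤ {p} i j pp p∣ij
  with euclidsLemma ∣ i ∣ ∣ j ∣ pp (subst (p ℕ.∣_) (ℤ.abs-* i j) (∣⇒∣ᵤ p∣ij))
... | inj₁ p∣i = inj₁ (∣ᵤ⇒∣ p∣i)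
... | inj₂ p∣j = inj₂ (∣ᵤ⇒∣ p∣j)

prime∣square⇒∣ : ∀ {p} i → Prime p → + p ∣ i * i → + p ∣ i
prime∣square⇒∣ i pp p∣i² with euclidsLemmaℤ i i pp p∣i²
... | inj₁ p∣i = p∣i
... | inj₂ p∣i = p∣i

prime∣prime*⇒∣ : ∀ {p q} i → Prime p → Prime q → p ≢ q → + p ∣ + q * i → + p ∣ i
prime∣prime*⇒∣ {p} {q} i pp pq p≢q p∣qi with euclidsLemmaℤ (+ q) i pp p∣qi
... | inj₂ p∣i = p∣i
... | inj₁ p∣q = ⊥-elim (p≢q (∣prime⇒≡ pq (∣⇒∣ᵤ p∣q) (ℕ.nonTrivial⇒n>1 p {{prime⇒nonTrivial pp}})))

prime[5] : Prime 5
prime[5] = toWitness {a? = prime? 5} tt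

prime²∤prime : ∀ {p} → Prime p → ¬ (+ p * + p ∣ + p)
prime²∤prime {p} pp p²∣p = ℕ.nonTrivial⇒≢1 {{prime⇒nonTrivial pp}} (ℕ.∣1⇒≡1 (∣⇒∣ᵤ p∣1))
  where
  instance _ = prime⇒nonZero pp
  p∣1 : + p ∣ + 1
  p∣1 = *-cancelˡ-∣ (+ p) (subst (+ p * + p ∣_) (sym (ℤ.*-identityʳ (+ p))) p²∣p)

infix 4 _∣ᵥ_ _∣ʰ_

_∣ᵥ_ : ℤ → ℤ³ → Set
k ∣ᵥ ⟨ a , b , c ⟩ = (k ∣ a) × (k ∣ b) × (k ∣ c)

_∣ʰ_ : ℤ → ℍ → Set
k ∣ʰ quaternion a b c d = (k ∣ a) × (k ∣ b) × (k ∣ c) × (k ∣ d)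

*-mono-∣ : ∀ {i j k l} → i ∣ j → k ∣ l → i * k ∣ j * l
*-mono-∣ {i} {l = l} i∣j k∣l = ∣-trans (*-monoʳ-∣ i k∣l) (*-monoˡ-∣ l i∣j)

∣ᵥ⇒∣· : ∀ {k} v s → k ∣ᵥ v → k ∣ v · s
∣ᵥ⇒∣· ⟨ a , b , c ⟩ ⟨ x , y , z ⟩ (k∣a , k∣b , k∣c) =
  ∣m∣n⇒∣m+n (∣m∣n⇒∣m+n (∣m⇒∣m*n x k∣a) (∣m⇒∣m*n y k∣b)) (∣m⇒∣m*n z k∣c)

∣ᵥ-⨯ : ∀ {k} u v → k ∣ᵥ u → k ∣ᵥ v → k * k ∣ᵥ u ⨯ v
∣ᵥ-⨯ ⟨ a , b , c ⟩ ⟨ x , y , z ⟩ (k∣a , k∣b , k∣c) (k∣x , k∣y , k∣z) =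
  ∣m∣n⇒∣m-n (*-mono-∣ k∣b k∣z) (*-mono-∣ k∣c k∣y) ,
  ∣m∣n⇒∣m-n (*-mono-∣ k∣c k∣x) (*-mono-∣ k∣a k∣z) ,
  ∣m∣n⇒∣m-n (*-mono-∣ k∣a k∣y) (*-mono-∣ k∣b k∣x)

∣ʰ⇒∣norm : ∀ {k} q → k ∣ʰ q → k * k ∣ norm q
∣ʰ⇒∣norm (quaternion a b c d) (k∣a , k∣b , k∣c , k∣d) =
  ∣m∣n⇒∣m+n (∣m∣n⇒∣m+n (∣m∣n⇒∣m+n (*-mono-∣ k∣a k∣a) (*-mono-∣ k∣b k∣b)) (*-mono-∣ k∣c k∣c))
            (*-mono-∣ k∣d k∣d)

odd-prime∣4*square⇒∣ : ∀ {p} i → Prime p → p ≢ 2 → + p ∣ + 4 * (i * i) → + p ∣ i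
odd-prime∣4*square⇒∣ i pp p≢2 p∣4i² = prime∣square⇒∣ i pp
  (prime∣prime*⇒∣ _ pp prime[2] p≢2 (prime∣prime*⇒∣ _ pp prime[2] p≢2
    (subst (_ ∣_) (ℤ.*-assoc (+ 2) (+ 2) (i * i)) p∣4i²)))

-- Rotations modulo a prime

diagonal⇒∣ʰ : ∀ {p} q → Prime p → p ≢ 2 → + p ∣ norm q → (∀ v → + p ∣ rotate q v · v) → + p ∣ʰ q
diagonal⇒∣ʰ (quaternion a b c d) pp p≢2 p∣N p∣δ =
  odd-prime∣4*square⇒∣ a pp p≢2 (subst (_ ∣_) (sym 4a²) (∣m∣n⇒∣m+n (∣m∣n⇒∣m+n (∣m∣n⇒∣m+n p∣N δ₁) δ₂) δ₃)) ,
  odd-prime∣4*square⇒∣ b pp p≢2 (subst (_ ∣_) (sym 4b²) (∣m∣n⇒∣m-n (∣m∣n⇒∣m-n (∣m∣n⇒∣m+n p∣N δ₁) δ₂) δ₃)) ,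
  odd-prime∣4*square⇒∣ c pp p≢2 (subst (_ ∣_) (sym 4c²) (∣m∣n⇒∣m-n (∣m∣n⇒∣m+n (∣m∣n⇒∣m-n p∣N δ₁) δ₂) δ₃)) ,
  odd-prime∣4*square⇒∣ d pp p≢2 (subst (_ ∣_) (sym 4d²) (∣m∣n⇒∣m+n (∣m∣n⇒∣m-n (∣m∣n⇒∣m-n p∣N δ₁) δ₂) δ₃))
  where
  δ₁ = p∣δ e₁
  δ₂ = p∣δ e₂
  δ₃ = p∣δ e₃
  4a² = proj₁ (diagonal-identities a b c d)
  4b² = proj₁ (proj₂ (diagonal-identities a b c d))
  4c² = proj₁ (proj₂ (proj₂ (diagonal-identities a b c d)))
  4d² = proj₂ (proj₂ (proj₂ (diagonal-identities a b c d)))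

record Frame : Set where
  constructor frame
  field
    u v : ℤ³
    ∣u∣²≡5 : ∣ u ∣² ≡ + 5
    ∣v∣²≡5 : ∣ v ∣² ≡ + 5
    u·v≡0 : u · v ≡ + 0

frame-expansion : (F : Frame) → let open Frame F in ∀ a b →
  + 25 * (a · b) ≡ + 5 * ((u · a) * (u · b)) + + 5 * ((v · a) * (v · b)) + (u ⨯ v · a) * (u ⨯ v · b)
frame-expansion (frame u v ∣u∣²≡5 ∣v∣²≡5 u·v≡0) a b = begin
  + 25 * (a · b)                                   ≡⟨ cong (_* (a · b)) ∣u⨯v∣²≡25 ⟨
  ∣ u ⨯ v ∣² * (a · b)                             ≡⟨ ℤ.+-identityʳ _ ⟨
  ∣ u ⨯ v ∣² * (a · b) + + 0 * mixed               ≡⟨ cong (λ t → ∣ u ⨯ v ∣² * (a · b) + t * mixed) u·v≡0 ⟨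
  ∣ u ⨯ v ∣² * (a · b) + u · v * mixed             ≡⟨ gram-identity u v a b ⟩
  ∣ v ∣² * ((u · a) * (u · b)) + ∣ u ∣² * ((v · a) * (v · b)) + (u ⨯ v · a) * (u ⨯ v · b)
    ≡⟨ cong₂ (λ s t → s * ((u · a) * (u · b)) + t * ((v · a) * (v · b)) + (u ⨯ v · a) * (u ⨯ v · b))
             ∣v∣²≡5 ∣u∣²≡5 ⟩
  + 5 * ((u · a) * (u · b)) + + 5 * ((v · a) * (v · b)) + (u ⨯ v · a) * (u ⨯ v · b) ∎
  where
  open ≡-Reasoning
  mixed = (u · a) * (v · b) + (v · a) * (u · b)
  ∣u⨯v∣²≡25 : ∣ u ⨯ v ∣² ≡ + 25
  ∣u⨯v∣²≡25 = trans (lagrange-identity u v)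
    (cong₂ _-_ (cong₂ _*_ ∣u∣²≡5 ∣v∣²≡5) (cong₂ _*_ u·v≡0 u·v≡0))

-- Were both rotated vectors divisible by p, so would be the rotation of u ⨯ v and hence, as the
-- frame spans 25ℤ³, the whole rotation matrix; its diagonal and the norm then make p divide q̄.
frame-escapes-rotation-kernel : ∀ {p} q → Prime p → p ≢ 2 → p ≢ 5 → norm q ≡ + p → (F : Frame) →
  + p ∣ᵥ rotate q (Frame.u F) → + p ∣ᵥ rotate q (Frame.v F) → ⊥
frame-escapes-rotation-kernel {p} q pp p≢2 p≢5 N≡p F p∣Ru p∣Rv =
  prime²∤prime pp (subst (+ p * + p ∣_) (trans (norm-conj q) N≡p) (∣ʰ⇒∣norm (conj q) p∣q̄))
  where
  open Frame F
  instance _ = prime⇒nonZero pp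
  p∣Rw : ∀ s → + p ∣ rotate q (u ⨯ v) · s
  p∣Rw s = *-cancelˡ-∣ (+ p) (subst (+ p * + p ∣_)
    (trans (rotate-⨯ q u v s) (cong (_* (rotate q (u ⨯ v) · s)) N≡p)) (∣ᵥ⇒∣· _ s (∣ᵥ-⨯ _ _ p∣Ru p∣Rv)))
  p∣·R̄ : ∀ x → (∀ s → + p ∣ rotate q x · s) → ∀ s → + p ∣ x · rotate (conj q) s
  p∣·R̄ x p∣Rx s = subst (+ p ∣_) (rotate-adjoint q x s) (p∣Rx s)
  p∣diagonal : ∀ s → + p ∣ rotate (conj q) s · s
  p∣diagonal s = prime∣prime*⇒∣ _ pp prime[5] p≢5 (prime∣prime*⇒∣ _ pp prime[5] p≢5
    (subst (+ p ∣_) (trans (sym (frame-expansion F a s)) (ℤ.*-assoc (+ 5) (+ 5) (a · s)))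
      (∣m∣n⇒∣m+n (∣m∣n⇒∣m+n (∣n⇒∣m*n (+ 5) (∣m⇒∣m*n (u · s) (p∣·R̄ u (λ s → ∣ᵥ⇒∣· _ s p∣Ru) s)))
                            (∣n⇒∣m*n (+ 5) (∣m⇒∣m*n (v · s) (p∣·R̄ v (λ s → ∣ᵥ⇒∣· _ s p∣Rv) s))))
                 (∣m⇒∣m*n (u ⨯ v · s) (p∣·R̄ (u ⨯ v) p∣Rw s)))))
    where a = rotate (conj q) s
  p∣q̄ : + p ∣ʰ conj q
  p∣q̄ = diagonal⇒∣ʰ (conj q) pp p≢2 (subst (+ p ∣_) (sym (trans (norm-conj q) N≡p)) ∣-refl) p∣diagonal

frames : List Frame
frames =
  frame ⟨ + 1 , + 2 , + 0 ⟩ ⟨ + 2 , - + 1 , + 0 ⟩ refl refl refl ∷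
  frame ⟨ + 1 , - + 2 , + 0 ⟩ ⟨ + 2 , + 1 , + 0 ⟩ refl refl refl ∷
  frame ⟨ + 1 , + 0 , + 2 ⟩ ⟨ + 2 , + 0 , - + 1 ⟩ refl refl refl ∷
  frame ⟨ + 1 , + 0 , - + 2 ⟩ ⟨ + 2 , + 0 , + 1 ⟩ refl refl refl ∷
  frame ⟨ + 0 , + 1 , + 2 ⟩ ⟨ + 0 , + 2 , - + 1 ⟩ refl refl refl ∷ []

-- Residues modulo 5

residues : List ℤ
residues = map +_ (upTo 5)

reduce-mod-5 : ∀ a → ∃[ a′ ] a′ ∈ residues × ∃[ k ] a ≡ a′ + + 5 * k
reduce-mod-5 a = + (a %ℕ 5) , ∈-map⁺ +_ (∈-upTo⁺ (n%ℕd<d a 5)) , a /ℕ 5 ,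
  trans (a≡a%ℕn+[a/ℕn]*n a 5) (cong (_+_ (+ (a %ℕ 5))) (ℤ.*-comm (a /ℕ 5) (+ 5)))

5∣x⇒5∣x+5y : ∀ x y → + 5 ∣ x → + 5 ∣ x + + 5 * y
5∣x⇒5∣x+5y x y 5∣x = ∣m∣n⇒∣m+n 5∣x (∣m⇒∣m*n y ∣-refl)

5∣x+5y⇒5∣x : ∀ x y → + 5 ∣ x + + 5 * y → + 5 ∣ x
5∣x+5y⇒5∣x x y 5∣x+5y = ∣m+n∣n⇒∣m 5∣x+5y (∣m⇒∣m*n y ∣-refl)

NonzeroSquareMod5 : ℤ → Set
NonzeroSquareMod5 x = (+ 5 ∣ x - + 1) ⊎ (+ 5 ∣ x + + 1)

nonzeroSquareMod5? : ∀ x → Dec (NonzeroSquareMod5 x)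
nonzeroSquareMod5? x = (+ 5 ∣? x - + 1) ⊎-dec (+ 5 ∣? x + + 1)

nonzeroSquareMod5-shift : ∀ x y → NonzeroSquareMod5 x ⇔ NonzeroSquareMod5 (x + + 5 * y)
nonzeroSquareMod5-shift x y =
  mk⇔ (Sum.map (to (shift⁻ x y)) (to (shift⁺ x y))) (Sum.map (from (shift⁻ x y)) (from (shift⁺ x y)))
  where
  shift⁻ : ∀ x y → x - + 1 + + 5 * y ≡ x + + 5 * y - + 1
  shift⁻ = solve-∀
  shift⁺ : ∀ x y → x + + 1 + + 5 * y ≡ x + + 5 * y + + 1
  shift⁺ = solve-∀
  to : ∀ {z z′} → z + + 5 * y ≡ z′ → + 5 ∣ z → + 5 ∣ z′
  to z+5y≡z′ 5∣z = subst (+ 5 ∣_) z+5y≡z′ (5∣x⇒5∣x+5y _ y 5∣z)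
  from : ∀ {z z′} → z + + 5 * y ≡ z′ → + 5 ∣ z′ → + 5 ∣ z
  from z+5y≡z′ 5∣z′ = 5∣x+5y⇒5∣x _ y (subst (+ 5 ∣_) (sym z+5y≡z′) 5∣z′)

square-residues : All (λ n → (+ 5 ∣ n) ⊎ NonzeroSquareMod5 (n * n)) residues
square-residues = toWitness {a? = all? (λ n → (+ 5 ∣? n) ⊎-dec nonzeroSquareMod5? (n * n)) residues} tt

square-mod-5 : ∀ n → (+ 5 ∣ n) ⊎ NonzeroSquareMod5 (n * n)
square-mod-5 n with reduce-mod-5 n
... | n′ , n′∈ , k , refl = Sum.map (5∣x⇒5∣x+5y n′ k) shift (All.lookup square-residues n′∈)
  where
  square-shift : ∀ n k → n * n + + 5 * (+ 2 * n * k + + 5 * k * k) ≡ (n + + 5 * k) * (n + + 5 * k)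
  square-shift = solve-∀
  shift : NonzeroSquareMod5 (n′ * n′) → NonzeroSquareMod5 ((n′ + + 5 * k) * (n′ + + 5 * k))
  shift ±1 = subst NonzeroSquareMod5 (square-shift n′ k)
    (Equivalence.to (nonzeroSquareMod5-shift (n′ * n′) _) ±1)

OrthogonalMod5 : ℤ³ → Frame → Set
OrthogonalMod5 r F = (+ 5 ∣ Frame.u F · r) × (+ 5 ∣ Frame.v F · r)

OrthogonalFrameMod5 : ℤ³ → Set
OrthogonalFrameMod5 r = Any (OrthogonalMod5 r) frames

orthogonalFrameMod5? : ∀ r → Dec (OrthogonalFrameMod5 r)
orthogonalFrameMod5? r = any? (λ F → (+ 5 ∣? Frame.u F · r) ×-dec (+ 5 ∣? Frame.v F · r)) frames

-- In each frame v ≡ 2u (mod 5), and over 𝔽₅ the plane orthogonal to r meets the conic |x|² = 0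
-- in two of its six points, one of which is a listed u.
frame-residues : All (λ a → All (λ b → All (λ c → let r = ⟨ a , b , c ⟩ in
  NonzeroSquareMod5 ∣ r ∣² → OrthogonalFrameMod5 r) residues) residues) residues
frame-residues = toWitness {a? = all? (λ a → all? (λ b → all? (λ c → let r = ⟨ a , b , c ⟩ in
  nonzeroSquareMod5? ∣ r ∣² →-dec orthogonalFrameMod5? r) residues) residues) residues} tt

orthogonal-frame-mod-5 : ∀ r → NonzeroSquareMod5 ∣ r ∣² → OrthogonalFrameMod5 r
orthogonal-frame-mod-5 ⟨ a , b , c ⟩ ±1 with reduce-mod-5 a | reduce-mod-5 b | reduce-mod-5 c
... | a′ , a′∈ , ka , refl | b′ , b′∈ , kb , refl | c′ , c′∈ , kc , refl =
  Any.map (λ {F} → shift F) (All.lookup (All.lookup (All.lookup frame-residues a′∈) b′∈) c′∈ unshifted)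
  where
  r′ = ⟨ a′ , b′ , c′ ⟩
  k = ⟨ ka , kb , kc ⟩
  unshifted : NonzeroSquareMod5 ∣ r′ ∣²
  unshifted = Equivalence.from (nonzeroSquareMod5-shift ∣ r′ ∣² _)
    (subst NonzeroSquareMod5 (∣⊕ᵥ⊛ᵥ∣² r′ (+ 5) k) ±1)
  shift : ∀ F → OrthogonalMod5 r′ F → OrthogonalMod5 (r′ ⊕ᵥ + 5 ⊛ᵥ k) F
  shift F (5∣u·r′ , 5∣v·r′) =
    subst (+ 5 ∣_) (sym (·-⊕ᵥ⊛ᵥ (Frame.u F) r′ (+ 5) k)) (5∣x⇒5∣x+5y _ _ 5∣u·r′) ,
    subst (+ 5 ∣_) (sym (·-⊕ᵥ⊛ᵥ (Frame.v F) r′ (+ 5) k)) (5∣x⇒5∣x+5y _ _ 5∣v·r′)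

-- Solutions of x² + y² + 5z² = p²

ProperSolution : ℕ → Set
ProperSolution n =
  ∃[ x ] ∃[ y ] ∃[ z ] ((∣ x ∣ < n) × (∣ y ∣ < n) × (x * x + y * y + + 5 * (z * z) ≡ + n * + n))

square-abs : ∀ x → x * x ≡ + (∣ x ∣ ℕ.* ∣ x ∣)
square-abs (+ n)    = ℤ.+◃n≡+n (n ℕ.* n)
square-abs -[1+ n ] = ℤ.+◃n≡+n (suc n ℕ.* suc n)

square-saturates : ∀ {a b p} → p ≤ a → a ℕ.* a ℕ.+ b ≡ p ℕ.* p → a ≡ p × b ≡ 0
square-saturates {a} {b} {p} p≤a a²+b≡p² = a≡p , ℕ.+-cancelˡ-≡ (p ℕ.* p) b 0 p²+b≡p²+0
  where
  a≤p : a ≤ p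
  a≤p = ℕ.≮⇒≥ λ p<a → ℕ.<⇒≱ (ℕ.*-mono-< p<a p<a) (subst (a ℕ.* a ≤_) a²+b≡p² (ℕ.m≤m+n (a ℕ.* a) b))
  a≡p : a ≡ p
  a≡p = ℕ.≤-antisym a≤p p≤a
  p²+b≡p²+0 : p ℕ.* p ℕ.+ b ≡ p ℕ.* p ℕ.+ 0
  p²+b≡p²+0 = trans (subst (λ t → t ℕ.* t ℕ.+ b ≡ p ℕ.* p) a≡p a²+b≡p²) (sym (ℕ.+-identityʳ _))

square≡0 : ∀ {n} → n ℕ.* n ≡ 0 → n ≡ 0
square≡0 {n} n²≡0 = Sum.[ id , id ]′ (ℕ.m*n≡0⇒m≡0∨n≡0 n n²≡0)

trivial-solution : ∀ {a b c p} → p ≤ a → a ℕ.* a ℕ.+ b ℕ.* b ℕ.+ 5 ℕ.* (c ℕ.* c) ≡ p ℕ.* p →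
  a ≡ p × b ≡ 0 × c ≡ 0
trivial-solution {a} {b} {c} p≤a eq with square-saturates p≤a (trans (sym (ℕ.+-assoc (a ℕ.* a) _ _)) eq)
... | a≡p , b²+5c²≡0 =
  a≡p , square≡0 (ℕ.m+n≡0⇒m≡0 (b ℕ.* b) b²+5c²≡0) , square≡0 (5*n≡0 (ℕ.m+n≡0⇒n≡0 (b ℕ.* b) b²+5c²≡0))
  where
  5*n≡0 : ∀ {n} → 5 ℕ.* n ≡ 0 → n ≡ 0
  5*n≡0 5n≡0 with ℕ.m*n≡0⇒m≡0∨n≡0 5 5n≡0
  ... | inj₂ n≡0 = n≡0

quadratic-form-abs : ∀ x y z →
  x * x + y * y + + 5 * (z * z) ≡ + (∣ x ∣ ℕ.* ∣ x ∣ ℕ.+ ∣ y ∣ ℕ.* ∣ y ∣ ℕ.+ 5 ℕ.* (∣ z ∣ ℕ.* ∣ z ∣))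
quadratic-form-abs x y z rewrite square-abs x | square-abs y | square-abs z =
  sym (trans (ℤ.pos-+ (X ℕ.+ Y) (5 ℕ.* Z)) (cong₂ _+_ (ℤ.pos-+ X Y) (ℤ.pos-* 5 Z)))
  where
  X = ∣ x ∣ ℕ.* ∣ x ∣
  Y = ∣ y ∣ ℕ.* ∣ y ∣
  Z = ∣ z ∣ ℕ.* ∣ z ∣

∣x∣≡p⇒p∣x : ∀ {p x} → ∣ x ∣ ≡ p → + p ∣ x
∣x∣≡p⇒p∣x refl = ∣ᵤ⇒∣ ℕ.∣-refl

∣x∣≡0⇒p∣x : ∀ {p x} → ∣ x ∣ ≡ 0 → + p ∣ x
∣x∣≡0⇒p∣x {p} ∣x∣≡0 = ∣ᵤ⇒∣ (subst (p ℕ.∣_) (sym ∣x∣≡0) (p ℕ.∣0))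

-- The only solutions with |x| ≥ p or |y| ≥ p are (±p, 0, 0) and (0, ±p, 0).
proper-or-divisible : ∀ p x y z → x * x + y * y + + 5 * (z * z) ≡ + p * + p →
  ProperSolution p ⊎ ((+ p ∣ x) × (+ p ∣ y) × (+ p ∣ z))
proper-or-divisible p x y z eq = decide (∣ x ∣ ℕ.<? p) (∣ y ∣ ℕ.<? p)
  where
  eqℕ : ∀ x y → x * x + y * y + + 5 * (z * z) ≡ + p * + p →
        ∣ x ∣ ℕ.* ∣ x ∣ ℕ.+ ∣ y ∣ ℕ.* ∣ y ∣ ℕ.+ 5 ℕ.* (∣ z ∣ ℕ.* ∣ z ∣) ≡ p ℕ.* p
  eqℕ x y eq = ℤ.+-injective (trans (sym (quadratic-form-abs x y z)) (trans eq (sym (ℤ.pos-* p p))))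
  decide : Dec (∣ x ∣ < p) → Dec (∣ y ∣ < p) → ProperSolution p ⊎ ((+ p ∣ x) × (+ p ∣ y) × (+ p ∣ z))
  decide (yes ∣x∣<p) (yes ∣y∣<p) = inj₁ (x , y , z , ∣x∣<p , ∣y∣<p , eq)
  decide (no ∣x∣≮p) _ with trivial-solution (ℕ.≮⇒≥ ∣x∣≮p) (eqℕ x y eq)
  ... | ∣x∣≡p , ∣y∣≡0 , ∣z∣≡0 = inj₂ (∣x∣≡p⇒p∣x ∣x∣≡p , ∣x∣≡0⇒p∣x ∣y∣≡0 , ∣x∣≡0⇒p∣x ∣z∣≡0)
  decide (yes _) (no ∣y∣≮p)
    with trivial-solution (ℕ.≮⇒≥ ∣y∣≮p) (eqℕ y x (trans (cong (_+ _) (ℤ.+-comm (y * y) (x * x))) eq))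
  ... | ∣y∣≡p , ∣x∣≡0 , ∣z∣≡0 = inj₂ (∣x∣≡0⇒p∣x ∣x∣≡0 , ∣x∣≡p⇒p∣x ∣y∣≡p , ∣x∣≡0⇒p∣x ∣z∣≡0)

lattice-coordinates : ∀ a b c → + 5 ∣ a → + 5 ∣ b + + 2 * c →
  ∃[ X ] ∃[ Y ] ∃[ Z ] ⟨ a , b , c ⟩ ≡ ⟨ + 5 * X , Y + + 2 * Z , + 2 * Y - Z ⟩
lattice-coordinates a b c (divides X a≡X*5) (divides Y b+2c≡Y*5) =
  X , Y , + 2 * Y - c , ℤ³-cong (trans a≡X*5 (ℤ.*-comm X (+ 5))) b≡ (c≡ Y c)
  where
  b≡ : b ≡ Y + + 2 * (+ 2 * Y - c)
  b≡ = trans (unshift b c) (trans (cong (_- + 2 * c) b+2c≡Y*5) (regroup Y c))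
    where
    unshift : ∀ b c → b ≡ b + + 2 * c - + 2 * c
    unshift = solve-∀
    regroup : ∀ Y c → Y * + 5 - + 2 * c ≡ Y + + 2 * (+ 2 * Y - c)
    regroup = solve-∀
  c≡ : ∀ Y c → c ≡ + 2 * Y - (+ 2 * Y - c)
  c≡ = solve-∀

lattice-solution : ∀ p a b c → ∣ ⟨ a , b , c ⟩ ∣² ≡ + 5 * (+ p * + p) → + 5 ∣ a → + 5 ∣ b + + 2 * c →
  ProperSolution p ⊎ (+ p ∣ᵥ ⟨ a , b , c ⟩)
lattice-solution p a b c ∣w∣²≡5p² 5∣a 5∣b+2c with lattice-coordinates a b c 5∣a 5∣b+2c
... | X , Y , Z , refl
    with proper-or-divisible p Y Z X (ℤ.*-cancelˡ-≡ (+ 5) _ _ (trans (sym (∣lattice∣² X Y Z)) ∣w∣²≡5p²))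
...   | inj₁ proper = inj₁ proper
...   | inj₂ (p∣Y , p∣Z , p∣X) =
  inj₂ (∣n⇒∣m*n (+ 5) p∣X , ∣m∣n⇒∣m+n p∣Y (∣n⇒∣m*n (+ 2) p∣Z) , ∣m∣n⇒∣m-n (∣n⇒∣m*n (+ 2) p∣Y) p∣Z)

5∣product-of-b±2c : ∀ a b c → + 5 ∣ ∣ ⟨ a , b , c ⟩ ∣² → + 5 ∣ a →
  + 5 ∣ (b + + 2 * c) * (b + + 2 * (- c))
5∣product-of-b±2c a b c 5∣∣w∣² 5∣a =
  ∣m+n∣m⇒∣n (∣m+n∣n⇒∣m 5∣sum (∣m⇒∣m*n (c * c) ∣-refl)) (∣m⇒∣m*n a 5∣a)
  where
  5∣sum = subst (+ 5 ∣_) (∣⟨⟩∣²-factorisation a b c) 5∣∣w∣²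

-- With 5 ∣ w₁ and 5 ∣ |w|², one of w₂ ± 2w₃ is a multiple of 5 and w lies in a lattice of the
-- form (5X, Y + 2Z, ±(2Y − Z)), on which |w|² = 5(Y² + Z² + 5X²).
proper-or-divisible-vector : ∀ p w → ∣ w ∣² ≡ + 5 * (+ p * + p) → + 5 ∣ Vector.x₁ w →
  ProperSolution p ⊎ (+ p ∣ᵥ w)
proper-or-divisible-vector p ⟨ a , b , c ⟩ ∣w∣²≡5p² 5∣a =
  Sum.[ lattice-solution p a b c ∣w∣²≡5p² 5∣a
      , (λ 5∣b−2c → Sum.map id unreflect
           (lattice-solution p a b (- c) (trans (∣reflect∣² a b c) ∣w∣²≡5p²) 5∣a 5∣b−2c)) ]′
    (euclidsLemmaℤ (b + + 2 * c) (b + + 2 * (- c)) prime[5] (5∣product-of-b±2c a b c 5∣∣w∣² 5∣a))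
  where
  5∣∣w∣² : + 5 ∣ ∣ ⟨ a , b , c ⟩ ∣²
  5∣∣w∣² = subst (+ 5 ∣_) (sym ∣w∣²≡5p²) (∣m⇒∣m*n (+ p * + p) ∣-refl)
  unreflect : + p ∣ᵥ ⟨ a , b , - c ⟩ → + p ∣ᵥ ⟨ a , b , c ⟩
  unreflect (p∣a , p∣b , p∣-c) = p∣a , p∣b , subst (+ p ∣_) (ℤ.neg-involutive c) (∣m⇒∣-m p∣-c)

proper-solution-from-quaternion : ∀ {p} q → Prime p → p ≢ 2 → p ≢ 5 → norm q ≡ + p → ProperSolution p
proper-solution-from-quaternion {p} q pp p≢2 p≢5 N≡p =
  from-frame (Any.satisfied (orthogonal-frame-mod-5 r ∣r∣²≡±1))
  where
  r : ℤ³
  r = rotate (conj q) e₁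
  ∣r∣²≡p² : ∣ r ∣² ≡ + p * + p
  ∣r∣²≡p² = trans (∣rotate∣² (conj q) e₁)
    (trans (cong (λ n → n * n * + 1) (trans (norm-conj q) N≡p)) (ℤ.*-identityʳ (+ p * + p)))
  ∣r∣²≡±1 : NonzeroSquareMod5 ∣ r ∣²
  ∣r∣²≡±1 = Sum.[ (λ 5∣p → ⊥-elim (p≢5 (sym (∣prime⇒≡ pp (∣⇒∣ᵤ 5∣p) (ℕ.nonTrivial⇒n>1 5)))))
               , subst NonzeroSquareMod5 (sym ∣r∣²≡p²) ]′ (square-mod-5 (+ p))
  candidate : ∀ x → ∣ x ∣² ≡ + 5 → + 5 ∣ x · r → ProperSolution p ⊎ (+ p ∣ᵥ rotate q x)
  candidate x ∣x∣²≡5 5∣x·r = proper-or-divisible-vector p (rotate q x) ∣Rx∣²≡5p² 5∣Rx₁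
    where
    ∣Rx∣²≡5p² : ∣ rotate q x ∣² ≡ + 5 * (+ p * + p)
    ∣Rx∣²≡5p² = trans (∣rotate∣² q x)
      (trans (cong₂ (λ n m → n * n * m) N≡p ∣x∣²≡5) (ℤ.*-comm (+ p * + p) (+ 5)))
    5∣Rx₁ : + 5 ∣ Vector.x₁ (rotate q x)
    5∣Rx₁ = subst (+ 5 ∣_) (trans (sym (rotate-adjoint q x e₁)) (·-e₁ (rotate q x))) 5∣x·r
  from-frame : ∃ (OrthogonalMod5 r) → ProperSolution p
  from-frame (F , 5∣u·r , 5∣v·r) = combine (candidate u ∣u∣²≡5 5∣u·r) (candidate v ∣v∣²≡5 5∣v·r)
    where
    open Frame F
    combine : ProperSolution p ⊎ (+ p ∣ᵥ rotate q u) → ProperSolution p ⊎ (+ p ∣ᵥ rotate q v) →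
              ProperSolution p
    combine (inj₁ proper) _             = proper
    combine (inj₂ _)      (inj₁ proper) = proper
    combine (inj₂ p∣Ru)   (inj₂ p∣Rv)   =
      ⊥-elim (frame-escapes-rotation-kernel q pp p≢2 p≢5 N≡p F p∣Ru p∣Rv)

-- Lagrange's four-square theorem for primes

%ℕ-≡⇒∣- : ∀ p .{{_ : ℕ.NonZero p}} x y → x %ℕ p ≡ y %ℕ p → + p ∣ x - y
%ℕ-≡⇒∣- p x y eq = divides (qx - qy) (begin
  x - y                                           ≡⟨ cong₂ _-_ (a≡a%ℕn+[a/ℕn]*n x p) (a≡a%ℕn+[a/ℕn]*n y p) ⟩
  (+ (x %ℕ p) + qx * + p) - (+ (y %ℕ p) + qy * + p) ≡⟨ cong (λ r → (+ r + qx * + p) - (+ (y %ℕ p) + qy * + p)) eq ⟩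
  (+ (y %ℕ p) + qx * + p) - (+ (y %ℕ p) + qy * + p) ≡⟨ cancel (+ (y %ℕ p)) qx qy (+ p) ⟩
  (qx - qy) * + p                                 ∎)
  where
  open ≡-Reasoning
  qx = x /ℕ p
  qy = y /ℕ p
  cancel : ∀ r a b p → (r + a * p) - (r + b * p) ≡ (a - b) * p
  cancel = solve-∀

+m-+n≡+[m∸n] : ∀ {m n} → n ≤ m → + m - + n ≡ + (m ℕ.∸ n)
+m-+n≡+[m∸n] {m} {n} n≤m = trans (ℤ.m-n≡m⊖n m n) (ℤ.⊖-≥ n≤m)

distinct-squares-mod-prime : ∀ {p a b} → Prime p → a < b → a ℕ.+ b < p → ¬ (+ p ∣ + b * + b - + a * + a)
distinct-squares-mod-prime {p} {a} {b} pp a<b a+b<p p∣b²-a² =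
  Sum.[ (λ p∣b-a → prime-∤-smaller pp (ℕ.m<n⇒0<n∸m a<b) b∸a<p
                     (subst (+ p ∣_) (+m-+n≡+[m∸n] (ℕ.<⇒≤ a<b)) p∣b-a))
      , (λ p∣b+a → prime-∤-smaller pp 0<b+a b+a<p (subst (+ p ∣_) (sym (ℤ.pos-+ b a)) p∣b+a)) ]′
    (euclidsLemmaℤ (+ b - + a) (+ b + + a) pp
      (subst (+ p ∣_) (difference-of-squares (+ b) (+ a)) p∣b²-a²))
  where
  difference-of-squares : ∀ b a → b * b - a * a ≡ (b - a) * (b + a)
  difference-of-squares = solve-∀
  b+a<p : b ℕ.+ a < p
  b+a<p = subst (_< p) (ℕ.+-comm a b) a+b<p
  b∸a<p : b ℕ.∸ a < p
  b∸a<p = ℕ.≤-<-trans (ℕ.m∸n≤m b a) (ℕ.≤-<-trans (ℕ.m≤m+n b a) b+a<p)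
  0<b+a : 0 < b ℕ.+ a
  0<b+a = ℕ.<-≤-trans (ℕ.≤-<-trans ℕ.z≤n a<b) (ℕ.m≤m+n b a)

module _ {p h : ℕ} (pp : Prime p) (p≡2h+1 : p ≡ suc (h ℕ.+ h)) where

  private
    instance _ = prime⇒nonZero pp

    value : ∀ n → Dec (n ≤ h) → ℤ
    value n (yes _) = + n * + n
    value n (no _)  = - (+ 1 + + (n ℕ.∸ suc h) * + (n ℕ.∸ suc h))

    valueᶠ : Fin (suc p) → ℤ
    valueᶠ i = value (toℕ i) (toℕ i ℕ.≤? h)

    residue : Fin (suc p) → Fin p
    residue i = fromℕ< (n%ℕd<d (valueᶠ i) p)

    below : ∀ {a b} → a ≤ h → b ≤ h → a ℕ.+ b < p
    below a≤h b≤h = subst (_ <_) (sym p≡2h+1) (ℕ.s≤s (ℕ.+-mono-≤ a≤h b≤h))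

    shifted≤h : ∀ {n} → n ≤ p → n ℕ.∸ suc h ≤ h
    shifted≤h {n} n≤p = subst (n ℕ.∸ suc h ≤_) (ℕ.m+n∸m≡n h h) (ℕ.∸-monoˡ-≤ (suc h) (subst (n ≤_) p≡2h+1 n≤p))

    collision : ∀ a b (a? : Dec (a ≤ h)) (b? : Dec (b ≤ h)) → a < b → b ≤ p →
      + p ∣ value a a? - value b b? → ∃[ a ] ∃[ b ] a ≤ h × b ≤ h × (+ p ∣ + a * + a + + b * + b + + 1)
    collision a b (yes a≤h) (yes b≤h) a<b _ p∣ =
      ⊥-elim (distinct-squares-mod-prime pp a<b (below a≤h b≤h)
        (subst (+ p ∣_) (flip (+ a * + a) (+ b * + b)) (∣m⇒∣-m p∣)))
      where
      flip : ∀ x y → - (x - y) ≡ y - x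
      flip = solve-∀
    collision a b (yes a≤h) (no b≰h) _ b≤p p∣ =
      a , b ℕ.∸ suc h , a≤h , shifted≤h b≤p , subst (+ p ∣_) (rearrange (+ a) (+ (b ℕ.∸ suc h))) p∣
      where
      rearrange : ∀ x y → x * x - - (+ 1 + y * y) ≡ x * x + y * y + + 1
      rearrange = solve-∀
    collision a b (no a≰h) (yes b≤h) a<b _ _ = ⊥-elim (a≰h (ℕ.<⇒≤ (ℕ.<-≤-trans a<b b≤h)))
    collision a b (no a≰h) (no b≰h) a<b b≤p p∣ =
      ⊥-elim (distinct-squares-mod-prime pp a′<b′
        (below (ℕ.<⇒≤ (ℕ.<-≤-trans a′<b′ (shifted≤h b≤p))) (shifted≤h b≤p))
        (subst (+ p ∣_) (rearrange (+ (a ℕ.∸ suc h)) (+ (b ℕ.∸ suc h))) p∣))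
      where
      a′<b′ : a ℕ.∸ suc h < b ℕ.∸ suc h
      a′<b′ = ℕ.∸-monoˡ-< a<b (ℕ.≰⇒> a≰h)
      rearrange : ∀ x y → - (+ 1 + x * x) - - (+ 1 + y * y) ≡ y * y - x * x
      rearrange = solve-∀

  -- Among the p + 1 integers a² and −1 − b² (0 ≤ a, b ≤ h) two are congruent modulo p; as no two
  -- of the a², and no two of the −1 − b², are, p divides some a² + b² + 1.
  two-squares-plus-one : ∃[ a ] ∃[ b ] a ≤ h × b ≤ h × (+ p ∣ + a * + a + + b * + b + + 1)
  two-squares-plus-one with pigeonhole (ℕ.n<1+n p) residue
  ... | i , j , i<j , ri≡rj =
    collision (toℕ i) (toℕ j) (toℕ i ℕ.≤? h) (toℕ j ℕ.≤? h) i<j (ℕ.s≤s⁻¹ (toℕ<n j))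
      (%ℕ-≡⇒∣- p (valueᶠ i) (valueᶠ j) (trans (sym (toℕ-fromℕ< _)) (trans (cong toℕ ri≡rj) (toℕ-fromℕ< _))))

odd-prime≡2h+1 : ∀ {p} → Prime p → p ≢ 2 → ∃[ h ] p ≡ suc (h ℕ.+ h)
odd-prime≡2h+1 {p} pp p≢2 = helper (p ℕ.% 2) (ℕ.m≡m%n+[m/n]*n p 2) (ℕ.m%n<n p 2)
  where
  helper : ∀ r → p ≡ r ℕ.+ p ℕ./ 2 ℕ.* 2 → r < 2 → ∃[ h ] p ≡ suc (h ℕ.+ h)
  helper 0 p≡2h _ = ⊥-elim (p≢2 (sym (∣prime⇒≡ pp (ℕ.divides (p ℕ./ 2) p≡2h) (ℕ.s≤s (ℕ.s≤s ℕ.z≤n)))))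
  helper 1 p≡2h+1 _ = p ℕ./ 2 , trans p≡2h+1 (cong suc (double (p ℕ./ 2)))
    where
    double : ∀ h → h ℕ.* 2 ≡ h ℕ.+ h
    double = ℕ-Ring.solve-∀
  helper (suc (suc _)) _ (ℕ.s≤s (ℕ.s≤s ()))

SumOfFourSquares : ℤ → Set
SumOfFourSquares n = ∃[ q ] norm q ≡ n

a²+b²+1<[2h+1]² : ∀ {a b h} → 0 < h → a ≤ h → b ≤ h →
  a ℕ.* a ℕ.+ b ℕ.* b ℕ.+ 1 < suc (h ℕ.+ h) ℕ.* suc (h ℕ.+ h)
a²+b²+1<[2h+1]² {h = h} 0<h a≤h b≤h =
  ℕ.≤-<-trans (ℕ.+-monoˡ-≤ 1 (ℕ.+-mono-≤ (ℕ.*-mono-≤ a≤h a≤h) (ℕ.*-mono-≤ b≤h b≤h)))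
    (subst (h ℕ.* h ℕ.+ h ℕ.* h ℕ.+ 1 <_) (sym (square h))
      (ℕ.m<m+n _ (ℕ.<-≤-trans (ℕ.*-monoʳ-< 4 {0} {h} 0<h) (ℕ.m≤n+m (4 ℕ.* h) (h ℕ.* h ℕ.+ h ℕ.* h)))))
  where
  square : ∀ h → suc (h ℕ.+ h) ℕ.* suc (h ℕ.+ h) ≡ h ℕ.* h ℕ.+ h ℕ.* h ℕ.+ 1 ℕ.+ (h ℕ.* h ℕ.+ h ℕ.* h ℕ.+ 4 ℕ.* h)
  square = ℕ-Ring.solve-∀

initial-multiple : ∀ {p} → Prime p → p ≢ 2 → ∃[ m ] 0 < m × m < p × SumOfFourSquares (+ m * + p)
initial-multiple {p} pp p≢2 = from-squares (two-squares-plus-one {h = h} pp p≡2h+1)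
  where
  h = proj₁ (odd-prime≡2h+1 pp p≢2)
  p≡2h+1 = proj₂ (odd-prime≡2h+1 pp p≢2)
  0<h : 0 < h
  0<h = ℕ.n≢0⇒n>0 λ h≡0 → ℕ.nonTrivial⇒≢1 {{prime⇒nonTrivial pp}} (trans p≡2h+1 (cong (λ h → suc (h ℕ.+ h)) h≡0))
  from-squares : ∃[ a ] ∃[ b ] a ≤ h × b ≤ h × (+ p ∣ + a * + a + + b * + b + + 1) →
                 ∃[ m ] 0 < m × m < p × SumOfFourSquares (+ m * + p)
  from-squares (a , b , a≤h , b≤h , p∣a²+b²+1) = from-quotient (∣⇒∣ᵤ (subst (+ p ∣_) +S≡+[S] p∣a²+b²+1))
    where
    S : ℕ
    S = a ℕ.* a ℕ.+ b ℕ.* b ℕ.+ 1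
    +S≡+[S] : + a * + a + + b * + b + + 1 ≡ + S
    +S≡+[S] = sym (trans (ℤ.pos-+ (a ℕ.* a ℕ.+ b ℕ.* b) 1)
      (cong (_+ + 1) (trans (ℤ.pos-+ (a ℕ.* a) (b ℕ.* b)) (cong₂ _+_ (ℤ.pos-* a a) (ℤ.pos-* b b)))))
    from-quotient : p ℕ.∣ S → ∃[ m ] 0 < m × m < p × SumOfFourSquares (+ m * + p)
    from-quotient (ℕ.divides m S≡m*p) = m , 0<m , m<p , quaternion (+ a) (+ b) (+ 1) (+ 0) ,
      trans (norm-a+bi+j (+ a) (+ b)) (trans +S≡+[S] (trans (cong +_ S≡m*p) (ℤ.pos-* m p)))
      where
      0<m : 0 < m
      0<m = ℕ.n≢0⇒n>0 λ { refl → case ℕ.m+n≡0⇒n≡0 (a ℕ.* a ℕ.+ b ℕ.* b) S≡m*p of λ () }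
      m<p : m < p
      m<p = ℕ.*-cancelʳ-< p m p (subst₂ _<_ S≡m*p (cong₂ ℕ._*_ (sym p≡2h+1) (sym p≡2h+1))
                                         (a²+b²+1<[2h+1]² 0<h a≤h b≤h))

centred-remainder : ∀ m .{{_ : ℕ.NonZero m}} x → ∃[ y ] ∃[ t ] (x ≡ y + + m * t) × (2 ℕ.* ∣ y ∣ ≤ m)
centred-remainder m x = choose (2 ℕ.* r ℕ.≤? m)
  where
  r = x %ℕ m
  q = x /ℕ m
  r≤m : r ≤ m
  r≤m = ℕ.<⇒≤ (n%ℕd<d x m)
  x≡r+mq : x ≡ + r + + m * q
  x≡r+mq = trans (a≡a%ℕn+[a/ℕn]*n x m) (cong (_+_ (+ r)) (ℤ.*-comm q (+ m)))
  choose : Dec (2 ℕ.* r ≤ m) → ∃[ y ] ∃[ t ] (x ≡ y + + m * t) × (2 ℕ.* ∣ y ∣ ≤ m)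
  choose (yes 2r≤m) = + r , q , x≡r+mq , 2r≤m
  choose (no 2r≰m) = + r - + m , q + + 1 , trans x≡r+mq (carry (+ r) (+ m) q) , 2∣r-m∣≤m
    where
    carry : ∀ r m q → r + m * q ≡ (r - m) + m * (q + + 1)
    carry = solve-∀
    twice : ∀ n → 2 ℕ.* n ≡ n ℕ.+ n
    twice = ℕ-Ring.solve-∀
    m∸r<r : m ℕ.∸ r < r
    m∸r<r = ℕ.+-cancelʳ-< r (m ℕ.∸ r) r
      (subst₂ _<_ (sym (ℕ.m∸n+n≡m r≤m)) (twice r) (ℕ.≰⇒> 2r≰m))
    2∣r-m∣≤m : 2 ℕ.* ∣ + r - + m ∣ ≤ m
    2∣r-m∣≤m = subst (λ n → 2 ℕ.* n ≤ m) (sym (trans (cong ∣_∣ (ℤ.m-n≡m⊖n r m)) (ℤ.∣⊖∣-≤ r≤m)))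
      (ℕ.<⇒≤ (subst₂ _<_ (sym (twice (m ℕ.∸ r))) (ℕ.m∸n+n≡m r≤m) (ℕ.+-monoʳ-< (m ℕ.∸ r) m∸r<r)))

Centred : ℕ → ℍ → Set
Centred m (quaternion a b c d) = (2 ℕ.* ∣ a ∣ ≤ m) × (2 ℕ.* ∣ b ∣ ≤ m) × (2 ℕ.* ∣ c ∣ ≤ m) × (2 ℕ.* ∣ d ∣ ≤ m)

centred-remainderʰ : ∀ m .{{_ : ℕ.NonZero m}} x → ∃[ y ] ∃[ t ] (x ≡ y ⊕ + m ⊛ t) × Centred m y
centred-remainderʰ m (quaternion a b c d) =
  let ya , ta , a≡ , ∣ya∣ = centred-remainder m a
      yb , tb , b≡ , ∣yb∣ = centred-remainder m b
      yc , tc , c≡ , ∣yc∣ = centred-remainder m c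
      yd , td , d≡ , ∣yd∣ = centred-remainder m d
  in quaternion ya yb yc yd , quaternion ta tb tc td , ℍ-cong a≡ b≡ c≡ d≡ , ∣ya∣ , ∣yb∣ , ∣yc∣ , ∣yd∣

normℕ : ℍ → ℕ
normℕ (quaternion a b c d) = ∣ a ∣ ℕ.* ∣ a ∣ ℕ.+ ∣ b ∣ ℕ.* ∣ b ∣ ℕ.+ ∣ c ∣ ℕ.* ∣ c ∣ ℕ.+ ∣ d ∣ ℕ.* ∣ d ∣

norm≡normℕ : ∀ q → norm q ≡ + normℕ q
norm≡normℕ (quaternion a b c d) = begin
  a * a + b * b + c * c + d * d
    ≡⟨ cong₂ _+_ (cong₂ _+_ (cong₂ _+_ (square-abs a) (square-abs b)) (square-abs c)) (square-abs d) ⟩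
  + A + + B + + C + + D
    ≡⟨ cong (_+ + D) (cong (_+ + C) (ℤ.pos-+ A B)) ⟨
  + (A ℕ.+ B) + + C + + D
    ≡⟨ cong (_+ + D) (ℤ.pos-+ (A ℕ.+ B) C) ⟨
  + (A ℕ.+ B ℕ.+ C) + + D
    ≡⟨ ℤ.pos-+ (A ℕ.+ B ℕ.+ C) D ⟨
  + (A ℕ.+ B ℕ.+ C ℕ.+ D) ∎
  where
  open ≡-Reasoning
  A = ∣ a ∣ ℕ.* ∣ a ∣
  B = ∣ b ∣ ℕ.* ∣ b ∣
  C = ∣ c ∣ ℕ.* ∣ c ∣
  D = ∣ d ∣ ℕ.* ∣ d ∣

four-times : ∀ n → n ℕ.+ n ℕ.+ n ℕ.+ n ≡ 4 ℕ.* n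
four-times = ℕ-Ring.solve-∀

sum-of-squares-bounded : ∀ {a b c d m} → a ≤ m → b ≤ m → c ≤ m → d ≤ m →
  a ℕ.* a ℕ.+ b ℕ.* b ℕ.+ c ℕ.* c ℕ.+ d ℕ.* d ≤ 4 ℕ.* (m ℕ.* m)
sum-of-squares-bounded {a} {b} {c} {d} {m} a≤m b≤m c≤m d≤m =
  subst (a ℕ.* a ℕ.+ b ℕ.* b ℕ.+ c ℕ.* c ℕ.+ d ℕ.* d ≤_) (four-times (m ℕ.* m))
  (ℕ.+-mono-≤ (ℕ.+-mono-≤ (ℕ.+-mono-≤ (ℕ.*-mono-≤ a≤m a≤m) (ℕ.*-mono-≤ b≤m b≤m)) (ℕ.*-mono-≤ c≤m c≤m))
              (ℕ.*-mono-≤ d≤m d≤m))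

sum-of-squares-maximal : ∀ {a b c d m} → a ≤ m → b ≤ m → c ≤ m → d ≤ m →
  a ℕ.* a ℕ.+ b ℕ.* b ℕ.+ c ℕ.* c ℕ.+ d ℕ.* d ≡ 4 ℕ.* (m ℕ.* m) → a ≡ m
sum-of-squares-maximal {m = m} a≤m b≤m c≤m d≤m sum≡4m² = ℕ.≤-antisym a≤m (ℕ.≮⇒≥ λ a<m →
  ℕ.<-irrefl (trans sum≡4m² (sym (four-times (m ℕ.* m))))
    (ℕ.+-mono-<-≤ (ℕ.+-mono-<-≤ (ℕ.+-mono-<-≤ (ℕ.*-mono-< a<m a<m) (ℕ.*-mono-≤ b≤m b≤m)) (ℕ.*-mono-≤ c≤m c≤m))
                  (ℕ.*-mono-≤ d≤m d≤m)))

odd-multiple : ∀ {m} y t → 2 ℕ.* ∣ y ∣ ≡ m → ∃[ s ] + 2 * (y + + m * t) ≡ + m * (+ 2 * s + + 1)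
odd-multiple (+ n) t refl = t ,
  subst (λ m → + 2 * (+ n + m * t) ≡ m * (+ 2 * t + + 1)) (sym (ℤ.pos-* 2 n)) (identity (+ n) t)
  where
  identity : ∀ y t → + 2 * (y + + 2 * y * t) ≡ + 2 * y * (+ 2 * t + + 1)
  identity = solve-∀
odd-multiple -[1+ n ] t refl = t - + 1 ,
  subst (λ m → + 2 * (- + suc n + m * t) ≡ m * (+ 2 * (t - + 1) + + 1)) (sym (ℤ.pos-* 2 (suc n)))
    (identity (+ suc n) t)
  where
  identity : ∀ y t → + 2 * (- y + + 2 * y * t) ≡ + 2 * y * (+ 2 * (t - + 1) + + 1)
  identity = solve-∀

mp≢m²K : ∀ {p m} → Prime p → 1 < m → m < p → ∀ K → + m * + p ≡ + m * + m * K → ⊥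
mp≢m²K {p} {m} pp 1<m m<p K mp≡m²K = ℕ.<⇒≢ m<p (∣prime⇒≡ pp m∣p 1<m)
  where
  instance _ = ℕ.>-nonZero (ℕ.<-trans ℕ.z<s 1<m)
  m∣p : m ℕ.∣ p
  m∣p = ∣⇒∣ᵤ (divides K (trans (ℤ.*-cancelˡ-≡ (+ m) (+ p) (+ m * K) (trans mp≡m²K (ℤ.*-assoc (+ m) (+ m) K)))
                               (ℤ.*-comm (+ m) K)))

normℕ≡0 : ∀ q → normℕ q ≡ 0 → q ≡ real (+ 0)
normℕ≡0 (quaternion a b c d) N≡0 = ℍ-cong (vanishes a A≡0) (vanishes b B≡0) (vanishes c C≡0) (vanishes d D≡0)
  where
  vanishes : ∀ x → ∣ x ∣ ℕ.* ∣ x ∣ ≡ 0 → x ≡ + 0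
  vanishes x x²≡0 = ℤ.∣i∣≡0⇒i≡0 (square≡0 x²≡0)
  ABC≡0 = ℕ.m+n≡0⇒m≡0 _ N≡0
  AB≡0  = ℕ.m+n≡0⇒m≡0 _ ABC≡0
  A≡0   = ℕ.m+n≡0⇒m≡0 _ AB≡0
  B≡0   = ℕ.m+n≡0⇒n≡0 (∣ a ∣ ℕ.* ∣ a ∣) AB≡0
  C≡0   = ℕ.m+n≡0⇒n≡0 (∣ a ∣ ℕ.* ∣ a ∣ ℕ.+ ∣ b ∣ ℕ.* ∣ b ∣) ABC≡0
  D≡0   = ℕ.m+n≡0⇒n≡0 (∣ a ∣ ℕ.* ∣ a ∣ ℕ.+ ∣ b ∣ ℕ.* ∣ b ∣ ℕ.+ ∣ c ∣ ℕ.* ∣ c ∣) N≡0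

doubles-squared≡4normℕ : ∀ a b c d →
  (2 ℕ.* ∣ a ∣) ℕ.* (2 ℕ.* ∣ a ∣) ℕ.+ (2 ℕ.* ∣ b ∣) ℕ.* (2 ℕ.* ∣ b ∣) ℕ.+
  (2 ℕ.* ∣ c ∣) ℕ.* (2 ℕ.* ∣ c ∣) ℕ.+ (2 ℕ.* ∣ d ∣) ℕ.* (2 ℕ.* ∣ d ∣) ≡ 4 ℕ.* normℕ (quaternion a b c d)
doubles-squared≡4normℕ a b c d = identity (∣ a ∣) (∣ b ∣) (∣ c ∣) (∣ d ∣)
  where
  identity : ∀ a b c d →
    (2 ℕ.* a) ℕ.* (2 ℕ.* a) ℕ.+ (2 ℕ.* b) ℕ.* (2 ℕ.* b) ℕ.+ (2 ℕ.* c) ℕ.* (2 ℕ.* c) ℕ.+ (2 ℕ.* d) ℕ.* (2 ℕ.* d)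
      ≡ 4 ℕ.* (a ℕ.* a ℕ.+ b ℕ.* b ℕ.+ c ℕ.* c ℕ.+ d ℕ.* d)
  identity = ℕ-Ring.solve-∀

sum-of-squares-all-maximal : ∀ {a b c d m} → a ≤ m → b ≤ m → c ≤ m → d ≤ m →
  a ℕ.* a ℕ.+ b ℕ.* b ℕ.+ c ℕ.* c ℕ.+ d ℕ.* d ≡ 4 ℕ.* (m ℕ.* m) → a ≡ m × b ≡ m × c ≡ m × d ≡ m
sum-of-squares-all-maximal {a} {b} {c} {d} a≤m b≤m c≤m d≤m sum≡4m² =
  sum-of-squares-maximal a≤m b≤m c≤m d≤m sum≡4m² ,
  sum-of-squares-maximal b≤m c≤m d≤m a≤m (trans (rotate₄ (a ℕ.* a) (b ℕ.* b) (c ℕ.* c) (d ℕ.* d)) sum≡4m²) ,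
  sum-of-squares-maximal c≤m d≤m a≤m b≤m (trans (rotate₄ (b ℕ.* b) (c ℕ.* c) (d ℕ.* d) (a ℕ.* a))
                                         (trans (rotate₄ (a ℕ.* a) (b ℕ.* b) (c ℕ.* c) (d ℕ.* d)) sum≡4m²)) ,
  sum-of-squares-maximal d≤m a≤m b≤m c≤m (trans (sym (rotate₄ (d ℕ.* d) (a ℕ.* a) (b ℕ.* b) (c ℕ.* c))) sum≡4m²)
  where
  rotate₄ : ∀ a b c d → b ℕ.+ c ℕ.+ d ℕ.+ a ≡ a ℕ.+ b ℕ.+ c ℕ.+ d
  rotate₄ = ℕ-Ring.solve-∀

euler-descent : ∀ {m p r} .{{_ : ℤ.NonZero m}} y t → norm y ≡ m * r → norm (y ⊕ m ⊛ t) ≡ m * p →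
  norm (real r ⊕ t ∙ conj y) ≡ r * p
euler-descent {m} {p} {r} y t N[y]≡mr N≡mp = ℤ.*-cancelˡ-≡ m _ _ (ℤ.*-cancelˡ-≡ m _ _ (begin
  m * (m * norm z)                            ≡⟨ ℤ.*-assoc m m (norm z) ⟨
  m * m * norm z                              ≡⟨ norm-real⊕⊛ m r (t ∙ conj y) ⟨
  norm (real (m * r) ⊕ m ⊛ (t ∙ conj y))      ≡⟨ cong (λ n → norm (real n ⊕ m ⊛ (t ∙ conj y))) N[y]≡mr ⟨
  norm (real (norm y) ⊕ m ⊛ (t ∙ conj y))     ≡⟨ euler-identity y m t ⟨
  norm (y ⊕ m ⊛ t) * norm y                   ≡⟨ cong₂ _*_ N≡mp N[y]≡mr ⟩
  m * p * (m * r)                             ≡⟨ rearrange m p r ⟩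
  m * (m * (r * p))                           ∎))
  where
  open ≡-Reasoning
  z = real r ⊕ t ∙ conj y
  rearrange : ∀ m p r → m * p * (m * r) ≡ m * (m * (r * p))
  rearrange = solve-∀

-- Here 2x = m(2s + 1) componentwise, and a sum of four odd squares is a multiple of 4, so m² ∣ m p.
¬half-remainders : ∀ {p m} → Prime p → 1 < m → m < p → ∀ a b c d t →
  2 ℕ.* ∣ a ∣ ≡ m × 2 ℕ.* ∣ b ∣ ≡ m × 2 ℕ.* ∣ c ∣ ≡ m × 2 ℕ.* ∣ d ∣ ≡ m →
  ¬ (norm (quaternion a b c d ⊕ + m ⊛ t) ≡ + m * + p)
¬half-remainders {p} {m} pp 1<m m<p a b c d t@(quaternion ta tb tc td)
                 (2∣a∣≡m , 2∣b∣≡m , 2∣c∣≡m , 2∣d∣≡m) N≡mp =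
  mp≢m²K pp 1<m m<p K (ℤ.*-cancelˡ-≡ (+ 4) _ _ (begin
    + 4 * (+ m * + p)          ≡⟨ cong (+ 4 *_) N≡mp ⟨
    + 2 * + 2 * norm x         ≡⟨ norm-⊛ (+ 2) x ⟨
    norm (+ 2 ⊛ x)             ≡⟨ cong norm 2x≡m·odd ⟩
    norm (+ m ⊛ odd)           ≡⟨ norm-⊛ (+ m) odd ⟩
    + m * + m * norm odd       ≡⟨ cong (+ m * + m *_) (norm-odd sa sb sc sd) ⟩
    + m * + m * (+ 4 * K)      ≡⟨ rearrange (+ m) K ⟩
    + 4 * (+ m * + m * K)      ∎))
  where
  open ≡-Reasoning
  x = quaternion a b c d ⊕ + m ⊛ t
  oa = odd-multiple a ta 2∣a∣≡m
  ob = odd-multiple b tb 2∣b∣≡m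
  oc = odd-multiple c tc 2∣c∣≡m
  od = odd-multiple d td 2∣d∣≡m
  sa = proj₁ oa
  sb = proj₁ ob
  sc = proj₁ oc
  sd = proj₁ od
  odd = quaternion (+ 2 * sa + + 1) (+ 2 * sb + + 1) (+ 2 * sc + + 1) (+ 2 * sd + + 1)
  K = sa * sa + sa + sb * sb + sb + sc * sc + sc + sd * sd + sd + + 1
  2x≡m·odd : + 2 ⊛ x ≡ + m ⊛ odd
  2x≡m·odd = ℍ-cong (proj₂ oa) (proj₂ ob) (proj₂ oc) (proj₂ od)
  rearrange : ∀ m K → m * m * (+ 4 * K) ≡ + 4 * (m * m * K)
  rearrange = solve-∀

-- Euler's descent: for x = y + m t with |yᵢ| ≤ m/2, m divides |y|² = r m, and x ȳ = |y|² + m t ȳ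
-- is m times a quaternion of norm r p; the bound on y gives r ≤ m, and r = 0 or r = m would make
-- m a proper divisor of p.
descent-step : ∀ {p m} → Prime p → 1 < m → m < p → ∀ y t → Centred m y →
  norm (y ⊕ + m ⊛ t) ≡ + m * + p → ∃[ r ] 0 < r × r < m × SumOfFourSquares (+ r * + p)
descent-step {p} {m} pp 1<m m<p y@(quaternion a b c d) t (2∣a∣≤m , 2∣b∣≤m , 2∣c∣≤m , 2∣d∣≤m) N≡mp =
  from-quotient (∣⇒∣ᵤ (subst (+ m ∣_) (norm≡normℕ y) m∣N[y]))
  where
  instance _ = ℕ.>-nonZero (ℕ.<-trans ℕ.z<s 1<m)
  m∣N[y] : + m ∣ norm y
  m∣N[y] = ∣m+n∣n⇒∣m (subst (+ m ∣_) (trans (sym N≡mp) (norm-⊕⊛ y (+ m) t)) (∣m⇒∣m*n (+ p) ∣-refl))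
                    (∣m⇒∣m*n _ ∣-refl)
  Σ[2yᵢ]²≡4normℕ = doubles-squared≡4normℕ a b c d
  from-quotient : m ℕ.∣ normℕ y → ∃[ r ] 0 < r × r < m × SumOfFourSquares (+ r * + p)
  from-quotient (ℕ.divides r N≡rm) =
    r , ℕ.n≢0⇒n>0 r≢0 , ℕ.≤∧≢⇒< r≤m r≢m ,
    real (+ r) ⊕ t ∙ conj y , euler-descent {+ m} {+ p} {+ r} y t N[y]≡mr N≡mp
    where
    r≤m : r ≤ m
    r≤m = ℕ.*-cancelʳ-≤ r m m (ℕ.*-cancelˡ-≤ 4 (subst₂ _≤_ (trans Σ[2yᵢ]²≡4normℕ (cong (4 ℕ.*_) N≡rm)) refl
      (sum-of-squares-bounded 2∣a∣≤m 2∣b∣≤m 2∣c∣≤m 2∣d∣≤m)))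
    N[y]≡mr : norm y ≡ + m * + r
    N[y]≡mr = trans (norm≡normℕ y) (trans (cong +_ N≡rm) (trans (ℤ.pos-* r m) (ℤ.*-comm (+ r) (+ m))))
    r≢0 : r ≢ 0
    r≢0 r≡0 = mp≢m²K pp 1<m m<p (norm t) (begin
      + m * + p                     ≡⟨ N≡mp ⟨
      norm (y ⊕ + m ⊛ t)            ≡⟨ cong (λ y → norm (y ⊕ + m ⊛ t)) y≡0 ⟩
      norm (real (+ 0) ⊕ + m ⊛ t)   ≡⟨ cong norm (⊕-identityˡ (+ m ⊛ t)) ⟩
      norm (+ m ⊛ t)                ≡⟨ norm-⊛ (+ m) t ⟩
      + m * + m * norm t            ∎)
      where
      open ≡-Reasoning
      y≡0 = normℕ≡0 y (trans N≡rm (cong (ℕ._* m) r≡0))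
    r≢m : r ≢ m
    r≢m r≡m = ¬half-remainders pp 1<m m<p a b c d t
      (sum-of-squares-all-maximal 2∣a∣≤m 2∣b∣≤m 2∣c∣≤m 2∣d∣≤m
        (trans Σ[2yᵢ]²≡4normℕ (cong (4 ℕ.*_) (trans N≡rm (cong (ℕ._* m) r≡m))))) N≡mp

four-squares-prime : ∀ {p} → Prime p → SumOfFourSquares (+ p)
four-squares-prime {p} pp = by-parity (p ℕ.≟ 2)
  where
  Descends : ℕ → Set
  Descends m = 0 < m → m < p → SumOfFourSquares (+ m * + p) → SumOfFourSquares (+ p)
  descend : ∀ m → (∀ {r} → r < m → Descends r) → Descends m
  descend 0 _ ()
  descend 1 _ _ _ (x , N≡1p) = x , trans N≡1p (ℤ.*-identityˡ (+ p))
  descend m@(suc (suc _)) smaller _ m<p (x , N≡mp) =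
    let y , t , x≡y+mt , centred = centred-remainderʰ m x
        r , 0<r , r<m , z = descent-step pp (ℕ.s<s ℕ.z<s) m<p y t centred (trans (cong norm (sym x≡y+mt)) N≡mp)
    in smaller r<m 0<r (ℕ.<-trans r<m m<p) z
  by-parity : Dec (p ≡ 2) → SumOfFourSquares (+ p)
  by-parity (yes p≡2) = quaternion (+ 1) (+ 1) (+ 0) (+ 0) , sym (cong +_ p≡2)
  by-parity (no p≢2) = let m , 0<m , m<p , x = initial-multiple pp p≢2 in <-rec Descends descend m 0<m m<p x

proper-solution-odd-prime : ∀ {p} → Prime p → p ≢ 2 → ProperSolution p
proper-solution-odd-prime {p} pp p≢2 = by-case (p ℕ.≟ 5)
  where
  by-case : Dec (p ≡ 5) → ProperSolution p
  by-case (yes p≡5) =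
    subst ProperSolution (sym p≡5) (+ 3 , + 4 , + 0 , ℕ.<-trans (ℕ.n<1+n 3) (ℕ.n<1+n 4) , ℕ.n<1+n 4 , refl)
  by-case (no p≢5) = let q , N≡p = four-squares-prime pp in proper-solution-from-quaternion q pp p≢2 p≢5 N≡p

product-of-twos : ∀ {ps} → All (_≡ 2) ps → product ps ≡ 2 ^ length ps
product-of-twos [] = refl
product-of-twos (refl ∷ twos) = cong (2 ℕ.*_) (product-of-twos twos)

odd-prime-factor : ∀ n .{{_ : ℕ.NonZero n}} → ¬ IsPowerOfTwo n → ∃[ p ] Prime p × p ≢ 2 × p ℕ.∣ n
odd-prime-factor n ¬2^k = from-factors (All.all? (ℕ._≟ 2) factors)
  where
  open PrimeFactorisation (factorise n)
  from-factors : Dec (All (_≡ 2) factors) → ∃[ p ] Prime p × p ≢ 2 × p ℕ.∣ n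
  from-factors (yes twos) = ⊥-elim (¬2^k (length factors , trans isFactorisation (product-of-twos twos)))
  from-factors (no ¬twos) =
    let p , p∈ , p≢2 = find (¬All⇒Any¬ (ℕ._≟ 2) factors ¬twos)
    in p , All.lookup factorsPrime p∈ , p≢2 , subst (p ℕ.∣_) (sym isFactorisation) (∈⇒∣product p∈)

scale-solution : ∀ {p} k .{{_ : ℕ.NonZero k}} → ProperSolution p → ProperSolution (k ℕ.* p)
scale-solution {p} k (x , y , z , ∣x∣<p , ∣y∣<p , eq) =
  + k * x , + k * y , + k * z , scale-bound ∣x∣<p , scale-bound ∣y∣<p , (begin
    + k * x * (+ k * x) + + k * y * (+ k * y) + + 5 * (+ k * z * (+ k * z))
      ≡⟨ factor (+ k) x y z ⟩
    + k * + k * (x * x + y * y + + 5 * (z * z))  ≡⟨ cong (+ k * + k *_) eq ⟩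
    + k * + k * (+ p * + p)                      ≡⟨ regroup (+ k) (+ p) ⟩
    + k * + p * (+ k * + p)                      ≡⟨ cong₂ _*_ (ℤ.pos-* k p) (ℤ.pos-* k p) ⟨
    + (k ℕ.* p) * + (k ℕ.* p)                    ∎)
  where
  open ≡-Reasoning
  scale-bound : ∀ {w} → ∣ w ∣ < p → ∣ + k * w ∣ < k ℕ.* p
  scale-bound {w} ∣w∣<p = subst (_< k ℕ.* p) (sym (ℤ.abs-* (+ k) w)) (ℕ.*-monoʳ-< k ∣w∣<p)
  factor : ∀ k x y z →
    k * x * (k * x) + k * y * (k * y) + + 5 * (k * z * (k * z)) ≡ k * k * (x * x + y * y + + 5 * (z * z))
  factor = solve-∀
  regroup : ∀ k p → k * k * (p * p) ≡ k * p * (k * p)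
  regroup = solve-∀

lemma4p2 : (n : ℕ) → n > 0 → ¬ IsPowerOfTwo n →
  ∃[ x ] ∃[ y ] ∃[ z ]
    ((∣ x ∣ < n) × (∣ y ∣ < n) ×
     (x * x + y * y + + 5 * (z * z) ≡ + n * + n))
lemma4p2 n n>0 ¬2^k =
  let instance _ = ℕ.>-nonZero n>0
      p , pp , p≢2 , ℕ.divides k n≡kp = odd-prime-factor n ¬2^k
      instance _ = ℕ.≢-nonZero λ k≡0 → ℕ.<⇒≢ n>0 (sym (trans n≡kp (cong (ℕ._* p) k≡0)))
  in subst ProperSolution (sym n≡kp) (scale-solution k (proper-solution-odd-prime pp p≢2))
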